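{- Let $G$ be a $4$-connected graph with $|V(G)|\geqslant 7$ and let $R$ be a triangle of $G$. If $x\in V(R)$ with $d_G(x)\geqslant 5$, then there exists $y\in V(R)\setminus\{x\}$ such that the edge $xy$ is removable in $G$.
   Context: All graphs are finite, simple and undirected. For an edge $e$ of a $4$-connected graph $G$, the graph $G\ominus e$ is obtained from $G$ by deleting $e$ to get $G-e$, and then, for each endpoint $z$ of $e$ that has degree $3$ in $G-e$, deleting $z$ and adding edges between every pair of non-adjacent vertices of $N_{G-e}(z)$. An edge $e$ of a $4$-connected graph $G$ is called removable if $G\ominus e$ is still $4$-connected. -}

module Defs where

open import Data.Nat using (ℕ; _<_; _≤_; _≡ᵇ_)
open import Data.Bool using (Bool; true; false; _∧_; _∨_; not)
open import Data.Fin using (Fin; _≟_)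
open import Data.List using (List; length; filterᵇ; allFin; any)
open import Data.Product using (_×_; ∃; _,_)
open import Relation.Binary.PropositionalEquality using (_≡_)
open import Relation.Nullary.Decidable using (⌊_⌋)
open import Relation.Nullary using (¬_)

-- A graph whose vertices form a subset of Fin n.
-- V u = true  iff  u is a vertex;  E u v = true iff uv is an edge.
record Graph (n : ℕ) : Set where
  field
    V : Fin n → Bool
    E : Fin n → Fin n → Bool
open Graph public

record Simple {n : ℕ} (G : Graph n) : Set where
  field
    sym   : ∀ u v → E G u v ≡ E G v u
    irr   : ∀ u → E G u u ≡ false
    inV   : ∀ u v → E G u v ≡ true → V G u ≡ true

#_ : {n : ℕ} → (Fin n → Bool) → ℕ
#_ {n} p = length (filterᵇ p (allFin n))

order : {n : ℕ} → Graph n → ℕ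
order G = # (V G)

Adj : {n : ℕ} → Graph n → Fin n → Fin n → Bool
Adj G u v = V G u ∧ V G v ∧ E G u v

deg : {n : ℕ} → Graph n → Fin n → ℕ
deg G v = # (λ u → Adj G v u)

data Reach {n : ℕ} (G : Graph n) : Fin n → Fin n → Set where
  here : ∀ {u} → Reach G u u
  step : ∀ {u w v} → Adj G u w ≡ true → Reach G w v → Reach G u v

Connected : {n : ℕ} → Graph n → Set
Connected G = ∀ u v → V G u ≡ true → V G v ≡ true → Reach G u v

_─_ : {n : ℕ} → Graph n → (Fin n → Bool) → Graph n
G ─ X = record { V = λ u → V G u ∧ not (X u) ; E = E G }

Connectedₖ : {n : ℕ} → ℕ → Graph n → Set
Connectedₖ {n} k G = (k < order G) ×
  ((X : Fin n → Bool) → # (λ u → X u ∧ V G u) < k → Connected (G ─ X))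

_=ᵛ_ : {n : ℕ} → Fin n → Fin n → Bool
u =ᵛ v = ⌊ u ≟ v ⌋

deleteEdge : {n : ℕ} → Graph n → Fin n → Fin n → Graph n
deleteEdge G a b = record
  { V = V G
  ; E = λ u v → E G u v ∧ not ((u =ᵛ a ∧ v =ᵛ b) ∨ (u =ᵛ b ∧ v =ᵛ a)) }

-- G ⊖ e for e = ab: delete e; each endpoint z of degree 3 in G - e is
-- deleted and all pairs of distinct vertices of N_{G-e}(z) are made adjacent.
_⊖_ : {n : ℕ} → Graph n → Fin n × Fin n → Graph n
G ⊖ (a , b) = record { V = V' ; E = E' }
  where
  H : Graph _
  H = deleteEdge G a b
  d3 : Fin _ → Bool
  d3 z = deg H z ≡ᵇ 3
  V' : Fin _ → Bool
  V' u = V G u ∧ not ((u =ᵛ a ∧ d3 a) ∨ (u =ᵛ b ∧ d3 b))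
  new : Fin _ → Fin _ → Bool
  new u v = not (u =ᵛ v) ∧
    ((d3 a ∧ Adj H a u ∧ Adj H a v) ∨ (d3 b ∧ Adj H b u ∧ Adj H b v))
  E' : Fin _ → Fin _ → Bool
  E' u v = V' u ∧ V' v ∧ (E H u v ∨ new u v)

Removable : {n : ℕ} → Graph n → Fin n → Fin n → Set
Removable G a b = Connectedₖ 4 (G ⊖ (a , b))

module Submission where

-- Suppose neither xy nor xz is removable. A separator of G ⊖ xy with at most three vertices pulls
-- back to a near-separation (A, S, B) of G: a separation of G − xy with |S| ≤ 3, x ∈ A, y ∈ B and
-- B ≠ {y}; the common neighbour z lies in S. (When y has degree 3 in G − xy it is suppressed in
-- G ⊖ xy and its other neighbours become a clique, which forces them all onto one side.) The same
-- for xz gives (A′, S′, B′) with y ∈ S′. An edge leaving one of the four corners A ∩ A′, …, B ∩ B′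
-- must cross a separation, i.e. be xy or xz, so by 4-connectivity each nonempty corner has at least
-- four vertices on its border. These bounds, |S|, |S′| ≤ 3, deg x ≥ 5 and the existence of vertices
-- in B − y and B′ − z are arithmetically incompatible.

open import Defs
open import Data.Bool using (Bool; true; false; _∧_; _∨_; not; T; if_then_else_)
open import Data.Bool.Properties using (∧-identityʳ; ∧-zeroʳ; ∧-comm; ∧-assoc) renaming (_≟_ to _≟ᵇ_)
open import Data.Empty using (⊥; ⊥-elim)
open import Data.Fin using (Fin; zero; suc; _≟_)
open import Data.Fin.Properties using (suc-injective; any?)
open import Data.List using (length; filterᵇ; tabulate)
open import Data.Nat using (ℕ; zero; suc; _+_; _≤_; _<_; z≤n; s≤s; _≡ᵇ_)
open import Data.Nat.Properties hiding (_≟_; suc-injective)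
open import Data.Nat.Solver using (module +-*-Solver)
open import Data.Product using (_×_; ∃; _,_; proj₁; proj₂; swap)
open import Data.Sum using (_⊎_; inj₁; inj₂; [_,_]′)
open import Data.Vec.Functional using (_∷_)
open import Function using (_∘_)
open import Relation.Binary.PropositionalEquality using (_≡_; _≢_; refl; sym; trans; cong; subst)
open import Relation.Nullary using (¬_; yes; no; does)

∧⁺ : ∀ {a b} → a ≡ true → b ≡ true → a ∧ b ≡ true
∧⁺ refl refl = refl

∧⁻ˡ : ∀ {a b} → a ∧ b ≡ true → a ≡ true
∧⁻ˡ {true} _ = refl

∧⁻ʳ : ∀ {a b} → a ∧ b ≡ true → b ≡ true
∧⁻ʳ {true} e = e

∨⁺ˡ : ∀ {a b} → a ≡ true → a ∨ b ≡ true
∨⁺ˡ refl = refl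

∨⁺ʳ : ∀ {a b} → b ≡ true → a ∨ b ≡ true
∨⁺ʳ {true} _ = refl
∨⁺ʳ {false} e = e

∨⁻ : ∀ {a b} → a ∨ b ≡ true → a ≡ true ⊎ b ≡ true
∨⁻ {true} _ = inj₁ refl
∨⁻ {false} e = inj₂ e

∨-false : ∀ {a b} → a ≡ false → b ≡ false → a ∨ b ≡ false
∨-false refl refl = refl

not-true : ∀ {a} → not a ≡ true → a ≡ false
not-true {false} _ = refl

not-false : ∀ {a} → a ≡ false → not a ≡ true
not-false refl = refl

true≢false : ∀ {a} → a ≡ true → a ≡ false → ⊥
true≢false refl ()

true-or-false : ∀ a → a ≡ true ⊎ a ≡ false
true-or-false true = inj₁ refl
true-or-false false = inj₂ refl

=ᵛ-sound : ∀ {n} {u v : Fin n} → u =ᵛ v ≡ true → u ≡ v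
=ᵛ-sound {u = u} {v} e with u ≟ v | e
... | yes p | _ = p

=ᵛ-refl : ∀ {n} (u : Fin n) → u =ᵛ u ≡ true
=ᵛ-refl u with u ≟ u
... | yes _ = refl
... | no u≢u = ⊥-elim (u≢u refl)

=ᵛ-≢ : ∀ {n} {u v : Fin n} → u ≢ v → u =ᵛ v ≡ false
=ᵛ-≢ {u = u} {v} u≢v with u ≟ v
... | yes p = ⊥-elim (u≢v p)
... | no _ = refl

=ᵛ-false : ∀ {n} {u v : Fin n} → u =ᵛ v ≡ false → u ≢ v
=ᵛ-false {v = v} e refl = true≢false (=ᵛ-refl v) e

member-≢ : ∀ {n} (P : Fin n → Bool) {u v} → P u ≡ true → P v ≡ false → u ≢ v
member-≢ P pu pv refl = true≢false pu pv

-- Counting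

count : ∀ {n} → (Fin n → Bool) → ℕ
count {zero} p = 0
count {suc n} p = (if p zero then 1 else 0) + count (p ∘ suc)

#≡count : ∀ {n} (p : Fin n → Bool) → # p ≡ count p
#≡count {n} p = go n (λ i → i)
  where
  go : ∀ m (f : Fin m → Fin n) → length (filterᵇ p (tabulate f)) ≡ count (p ∘ f)
  go zero f = refl
  go (suc m) f with p (f zero)
  ... | true = cong suc (go m (f ∘ suc))
  ... | false = go m (f ∘ suc)

count-mono : ∀ {n} {p q : Fin n → Bool} → (∀ u → p u ≡ true → q u ≡ true) → count p ≤ count q
count-mono {zero} _ = z≤n
count-mono {suc n} {p} {q} p⊆q with p zero in ep | q zero in eq
... | true | true = s≤s (count-mono (p⊆q ∘ suc))
... | true | false = ⊥-elim (true≢false (p⊆q zero ep) eq)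
... | false | true = m≤n⇒m≤1+n (count-mono (p⊆q ∘ suc))
... | false | false = count-mono (p⊆q ∘ suc)

count-cong : ∀ {n} {p q : Fin n → Bool} → (∀ u → p u ≡ q u) → count p ≡ count q
count-cong p≗q = ≤-antisym (count-mono (λ u e → trans (sym (p≗q u)) e)) (count-mono (λ u e → trans (p≗q u) e))

count-∨ : ∀ {n} (p q : Fin n → Bool) → count (λ u → p u ∨ q u) ≤ count p + count q
count-∨ {zero} p q = z≤n
count-∨ {suc n} p q with p zero | q zero
... | true | true = s≤s (≤-trans (count-∨ (p ∘ suc) (q ∘ suc)) (+-monoʳ-≤ (count (p ∘ suc)) (n≤1+n _)))
... | true | false = s≤s (count-∨ (p ∘ suc) (q ∘ suc))
... | false | true = ≤-trans (s≤s (count-∨ (p ∘ suc) (q ∘ suc))) (≤-reflexive (sym (+-suc _ _)))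
... | false | false = count-∨ (p ∘ suc) (q ∘ suc)

count-∨-disjoint : ∀ {n} (p q : Fin n → Bool) → (∀ u → p u ≡ true → q u ≡ false) →
  count p + count q ≤ count (λ u → p u ∨ q u)
count-∨-disjoint {zero} p q _ = z≤n
count-∨-disjoint {suc n} p q disj with p zero in ep | q zero in eq
... | true | true = ⊥-elim (true≢false eq (disj zero ep))
... | true | false = s≤s (count-∨-disjoint (p ∘ suc) (q ∘ suc) (disj ∘ suc))
... | false | true = ≤-trans (≤-reflexive (+-suc _ _)) (s≤s (count-∨-disjoint (p ∘ suc) (q ∘ suc) (disj ∘ suc)))
... | false | false = count-∨-disjoint (p ∘ suc) (q ∘ suc) (disj ∘ suc)

count-≤-size : ∀ {n} (p : Fin n → Bool) → count p ≤ n
count-≤-size {zero} p = z≤n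
count-≤-size {suc n} p with p zero
... | true = s≤s (count-≤-size (p ∘ suc))
... | false = m≤n⇒m≤1+n (count-≤-size (p ∘ suc))

count-none : ∀ {n} (p : Fin n → Bool) → (∀ u → p u ≡ false) → count p ≡ 0
count-none {zero} p _ = refl
count-none {suc n} p none rewrite none zero = count-none (p ∘ suc) (none ∘ suc)

1≤count : ∀ {n} (p : Fin n → Bool) {u} → p u ≡ true → 1 ≤ count p
1≤count {suc n} p {zero} e rewrite e = s≤s z≤n
1≤count {suc n} p {suc u} e = ≤-trans (1≤count (p ∘ suc) e) (m≤n+m _ _)

1≤count⇒∃ : ∀ {n} (p : Fin n → Bool) → 1 ≤ count p → ∃ λ u → p u ≡ true
1≤count⇒∃ {suc n} p h with p zero in e
... | true = zero , e
... | false with 1≤count⇒∃ (p ∘ suc) h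
...   | u , e′ = suc u , e′

count-unique : ∀ {n} (p : Fin n → Bool) → (∀ {u v} → p u ≡ true → p v ≡ true → u ≡ v) → count p ≤ 1
count-unique {zero} p _ = z≤n
count-unique {suc n} p unique with p zero in e
... | false = count-unique (p ∘ suc) (λ pu pv → suc-injective (unique pu pv))
... | true = s≤s (≤-reflexive (count-none (p ∘ suc) (λ u → only u)))
  where
  only : ∀ u → p (suc u) ≡ false
  only u with true-or-false (p (suc u))
  ... | inj₂ f = f
  ... | inj₁ t with unique t e
  ...   | ()

count-=ᵛ : ∀ {n} (v : Fin n) → count (_=ᵛ v) ≤ 1
count-=ᵛ v = count-unique (_=ᵛ v) (λ e e′ → trans (=ᵛ-sound e) (sym (=ᵛ-sound e′)))

count-escape : ∀ {n} (P Q : Fin n → Bool) → count Q < count P → ∃ λ u → P u ≡ true × Q u ≡ false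
count-escape P Q Q<P = let (u , e) = 1≤count⇒∃ (λ u → P u ∧ not (Q u)) some in u , ∧⁻ˡ e , not-true (∧⁻ʳ {P u} e)
  where
  open ≤-Reasoning
  split : ∀ u → P u ≡ true → Q u ∨ (P u ∧ not (Q u)) ≡ true
  split u pu with Q u
  ... | true = refl
  ... | false = trans (∧-identityʳ (P u)) pu
  some : 1 ≤ count (λ u → P u ∧ not (Q u))
  some = +-cancelˡ-≤ (count Q) 1 _ (begin
    count Q + 1                                ≡⟨ +-comm (count Q) 1 ⟩
    suc (count Q)                              ≤⟨ Q<P ⟩
    count P                                    ≤⟨ count-mono split ⟩
    count (λ u → Q u ∨ (P u ∧ not (Q u)))      ≤⟨ count-∨ Q _ ⟩
    count Q + count (λ u → P u ∧ not (Q u))    ∎)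

2≤count : ∀ {n} (p : Fin n → Bool) {u v} → p u ≡ true → p v ≡ true → u ≢ v → 2 ≤ count p
2≤count p {u} {v} pu pv u≢v = begin
  2                                         ≤⟨ +-mono-≤ (1≤count (_=ᵛ u) (=ᵛ-refl u)) (1≤count (_=ᵛ v) (=ᵛ-refl v)) ⟩
  count (_=ᵛ u) + count (_=ᵛ v)             ≤⟨ count-∨-disjoint (_=ᵛ u) (_=ᵛ v) distinct ⟩
  count (λ w → (w =ᵛ u) ∨ (w =ᵛ v))         ≤⟨ count-mono two⊆p ⟩
  count p                                   ∎
  where
  open ≤-Reasoning
  distinct : ∀ w → w =ᵛ u ≡ true → w =ᵛ v ≡ false
  distinct w e = =ᵛ-≢ (λ w≡v → u≢v (trans (sym (=ᵛ-sound e)) w≡v))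
  two⊆p : ∀ w → (w =ᵛ u) ∨ (w =ᵛ v) ≡ true → p w ≡ true
  two⊆p w e with ∨⁻ {w =ᵛ u} e
  ... | inj₁ w≡u = subst (λ t → p t ≡ true) (sym (=ᵛ-sound w≡u)) pu
  ... | inj₂ w≡v = subst (λ t → p t ≡ true) (sym (=ᵛ-sound w≡v)) pv

count-disjoint₃ : ∀ {n} (p q r t : Fin n → Bool) →
  (∀ u → p u ≡ true → q u ≡ false) → (∀ u → p u ≡ true → r u ≡ false) → (∀ u → q u ≡ true → r u ≡ false) →
  (∀ u → p u ≡ true → t u ≡ true) → (∀ u → q u ≡ true → t u ≡ true) → (∀ u → r u ≡ true → t u ≡ true) →
  count p + count q + count r ≤ count t
count-disjoint₃ p q r t p∩q p∩r q∩r p⊆t q⊆t r⊆t =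
  ≤-trans (+-monoˡ-≤ (count r) (count-∨-disjoint p q p∩q))
  (≤-trans (count-∨-disjoint (λ u → p u ∨ q u) r disjoint) (count-mono covered))
  where
  disjoint : ∀ u → p u ∨ q u ≡ true → r u ≡ false
  disjoint u e = [ p∩r u , q∩r u ]′ (∨⁻ e)
  covered : ∀ u → (p u ∨ q u) ∨ r u ≡ true → t u ≡ true
  covered u e with ∨⁻ {p u ∨ q u} e
  ... | inj₂ ru = r⊆t u ru
  ... | inj₁ pq = [ p⊆t u , q⊆t u ]′ (∨⁻ pq)

_∩_ : ∀ {n} → (Fin n → Bool) → (Fin n → Bool) → Fin n → Bool
(p ∩ q) u = p u ∧ q u

∩-falseˡ : ∀ {n} (p q : Fin n → Bool) {u} → p u ≡ false → (p ∩ q) u ≡ false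
∩-falseˡ p q {u} e = cong (_∧ q u) e

∩-falseʳ : ∀ {n} (p q : Fin n → Bool) {u} → q u ≡ false → (p ∩ q) u ≡ false
∩-falseʳ p q {u} e = trans (cong (p u ∧_) e) (∧-zeroʳ (p u))

-- Walks and deciding 4-connectivity

module _ {n : ℕ} (L : Graph n) {p q : Fin n} where

  Adj⁺ : V L p ≡ true → V L q ≡ true → E L p q ≡ true → Adj L p q ≡ true
  Adj⁺ vp vq e = ∧⁺ vp (∧⁺ vq e)

  Adj-Vˡ : Adj L p q ≡ true → V L p ≡ true
  Adj-Vˡ = ∧⁻ˡ

  Adj-Vʳ : Adj L p q ≡ true → V L q ≡ true
  Adj-Vʳ a = ∧⁻ˡ (∧⁻ʳ {V L p} a)

  Adj-E : Adj L p q ≡ true → E L p q ≡ true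
  Adj-E a = ∧⁻ʳ {V L q} (∧⁻ʳ {V L p} a)

Reach-map : ∀ {n} {L L′ : Graph n} → (∀ {u w} → Adj L u w ≡ true → Adj L′ u w ≡ true) →
  ∀ {u v} → Reach L u v → Reach L′ u v
Reach-map f here = here
Reach-map f (step a r) = step (f a) (Reach-map f r)

Reach-snoc : ∀ {n} {L : Graph n} {u v w} → Reach L u v → Adj L v w ≡ true → Reach L u w
Reach-snoc here a = step a here
Reach-snoc (step a r) b = step a (Reach-snoc r b)

Reach-V : ∀ {n} {L : Graph n} {u v} → V L u ≡ true → Reach L u v → V L v ≡ true
Reach-V vu here = vu
Reach-V {L = L} vu (step a r) = Reach-V (Adj-Vʳ L a) r

module Closure {n : ℕ} (L : Graph n) where

  Closed : (Fin n → Bool) → Set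
  Closed C = ∀ {u w} → C u ≡ true → Adj L u w ≡ true → C w ≡ true

  expand : (Fin n → Bool) → Fin n → Bool
  expand C w = C w ∨ does (any? (λ u → (C u ∧ Adj L u w) ≟ᵇ true))

  expand⁻ : ∀ C {w} → expand C w ≡ true → C w ≡ true ⊎ ∃ λ u → C u ∧ Adj L u w ≡ true
  expand⁻ C {w} e with C w | any? (λ u → (C u ∧ Adj L u w) ≟ᵇ true)
  ... | true | _ = inj₁ refl
  ... | false | yes found = inj₂ found

  expand-edge : ∀ C {u w} → C u ≡ true → Adj L u w ≡ true → expand C w ≡ true
  expand-edge C {u} {w} cu a with C w | any? (λ u → (C u ∧ Adj L u w) ≟ᵇ true)
  ... | true | _ = refl
  ... | false | yes _ = refl
  ... | false | no none = ⊥-elim (none (u , ∧⁺ cu a))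

  ball : ℕ → Fin n → Fin n → Bool
  ball zero v = _=ᵛ v
  ball (suc k) v = expand (ball k v)

  ball-reach : ∀ k {v w} → ball k v w ≡ true → Reach L v w
  ball-reach zero e rewrite =ᵛ-sound e = here
  ball-reach (suc k) e with expand⁻ (ball k _) e
  ... | inj₁ inner = ball-reach k inner
  ... | inj₂ (u , e′) = Reach-snoc (ball-reach k (∧⁻ˡ e′)) (∧⁻ʳ {ball k _ u} e′)

  -- Each ball is closed or has more vertices than its radius, so the ball of radius n is closed.
  ball-grows : ∀ k v → Closed (ball k v) ⊎ suc k ≤ count (ball k v)
  ball-grows zero v = inj₂ (1≤count (_=ᵛ v) (=ᵛ-refl v))
  ball-grows (suc k) v with ball-grows k v
  ... | inj₁ closed = inj₁ λ cu a → expand-edge (ball k v) (still cu) a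
    where
    still : ∀ {u} → expand (ball k v) u ≡ true → ball k v u ≡ true
    still e with expand⁻ (ball k v) e
    ... | inj₁ inner = inner
    ... | inj₂ (u , e′) = closed (∧⁻ˡ e′) (∧⁻ʳ {ball k v u} e′)
  ... | inj₂ big with any? (λ w → (expand (ball k v) w ∧ not (ball k v w)) ≟ᵇ true)
  ...   | yes (w , new) = inj₂ (begin
          suc (suc k)                                   ≤⟨ s≤s big ⟩
          suc (count (ball k v))                        ≡⟨ +-comm 1 _ ⟩
          count (ball k v) + 1                          ≤⟨ +-monoʳ-≤ (count (ball k v)) (1≤count (_=ᵛ w) (=ᵛ-refl w)) ⟩
          count (ball k v) + count (_=ᵛ w)              ≤⟨ count-∨-disjoint (ball k v) (_=ᵛ w) fresh ⟩
          count (λ u → ball k v u ∨ (u =ᵛ w))           ≤⟨ count-mono grown ⟩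
          count (expand (ball k v))                     ∎)
    where
    open ≤-Reasoning
    fresh : ∀ u → ball k v u ≡ true → u =ᵛ w ≡ false
    fresh u e = =ᵛ-≢ (λ u≡w → true≢false (subst (λ t → ball k v t ≡ true) u≡w e) (not-true (∧⁻ʳ {expand (ball k v) w} new)))
    grown : ∀ u → ball k v u ∨ (u =ᵛ w) ≡ true → expand (ball k v) u ≡ true
    grown u e with ∨⁻ {ball k v u} e
    ... | inj₁ inner = ∨⁺ˡ inner
    ... | inj₂ u≡w = subst (λ t → expand (ball k v) t ≡ true) (sym (=ᵛ-sound u≡w)) (∧⁻ˡ new)
  ...   | no nothing-new = inj₁ λ cu a → ∨⁺ˡ (closed′ (still cu) a)
    where
    still : ∀ {u} → expand (ball k v) u ≡ true → ball k v u ≡ true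
    still {u} e with true-or-false (ball k v u)
    ... | inj₁ t = t
    ... | inj₂ f = ⊥-elim (nothing-new (u , ∧⁺ e (not-false f)))
    closed′ : Closed (ball k v)
    closed′ cu a = still (expand-edge (ball k v) cu a)

  closure : Fin n → Fin n → Bool
  closure = ball n

  closure-closed : ∀ v → Closed (closure v)
  closure-closed v with ball-grows n v
  ... | inj₁ closed = closed
  ... | inj₂ big = ⊥-elim (<-irrefl refl (≤-trans big (count-≤-size (closure v))))

  closure-self : ∀ v → closure v v ≡ true
  closure-self v = go n
    where
    go : ∀ k → ball k v v ≡ true
    go zero = =ᵛ-refl v
    go (suc k) = ∨⁺ˡ (go k)

record Disconnection {n : ℕ} (L : Graph n) : Set where
  field
    part : Fin n → Bool
    part⊆V : ∀ {u} → part u ≡ true → V L u ≡ true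
    closed : ∀ {u w} → part u ≡ true → Adj L u w ≡ true → part w ≡ true
    inside : Fin n
    inside∈ : part inside ≡ true
    outside : Fin n
    outside∈V : V L outside ≡ true
    outside∉ : part outside ≡ false

connected-or-disconnected : ∀ {n} (L : Graph n) → Connected L ⊎ Disconnection L
connected-or-disconnected {n} L
  with any? (λ u → any? (λ v → (V L u ∧ V L v ∧ not (closure u v)) ≟ᵇ true))
  where open Closure L
... | yes (u , v , e) = inj₂ record
  { part = closure u
  ; part⊆V = λ c → Reach-V (∧⁻ˡ e) (closure-reach c)
  ; closed = closure-closed u
  ; inside = u ; inside∈ = closure-self u
  ; outside = v ; outside∈V = ∧⁻ˡ (∧⁻ʳ {V L u} e) ; outside∉ = not-true (∧⁻ʳ {V L v} (∧⁻ʳ {V L u} e)) }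
  where
  open Closure L
  closure-reach : ∀ {w} → closure u w ≡ true → Reach L u w
  closure-reach = ball-reach n
... | no none = inj₁ λ u v vu vv → Closure.ball-reach L n (reached u v vu vv)
  where
  open Closure L
  reached : ∀ u v → V L u ≡ true → V L v ≡ true → closure u v ≡ true
  reached u v vu vv with true-or-false (closure u v)
  ... | inj₁ t = t
  ... | inj₂ f = ⊥-elim (none (u , v , ∧⁺ vu (∧⁺ vv (not-false f))))

-- Functions Fin n → Bool are not comparable by ≡, so P must respect pointwise equality.
all-or-counterexample : ∀ n {P Q : (Fin n → Bool) → Set} →
  (∀ {X Y} → (∀ i → X i ≡ Y i) → P X → P Y) → (∀ X → P X ⊎ Q X) → (∀ X → P X) ⊎ ∃ Q
all-or-counterexample zero resp decide with decide (λ ())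
... | inj₁ p = inj₁ λ X → resp (λ ()) p
... | inj₂ q = inj₂ (_ , q)
all-or-counterexample (suc n) {P} resp decide
  with all-or-counterexample n (λ eq → resp (extend true eq)) (decide ∘ (true ∷_))
     | all-or-counterexample n (λ eq → resp (extend false eq)) (decide ∘ (false ∷_))
  where
  extend : ∀ b {X Y : Fin n → Bool} → (∀ i → X i ≡ Y i) → ∀ i → (b ∷ X) i ≡ (b ∷ Y) i
  extend b eq zero = refl
  extend b eq (suc i) = eq i
... | inj₂ (X , q) | _ = inj₂ (true ∷ X , q)
... | inj₁ _ | inj₂ (X , q) = inj₂ (false ∷ X , q)
... | inj₁ pt | inj₁ pf = inj₁ λ X → resp (split X) (by-head (X zero) (X ∘ suc))
  where
  split : ∀ X → ∀ i → (X zero ∷ (X ∘ suc)) i ≡ X i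
  split X zero = refl
  split X (suc i) = refl
  by-head : ∀ b f → P (b ∷ f)
  by-head true = pt
  by-head false = pf

Obstruction : ∀ {n} → Graph n → Set
Obstruction {n} K = order K ≤ 4 ⊎ ∃ λ (X : Fin n → Bool) → # (λ u → X u ∧ V K u) < 4 × Disconnection (K ─ X)

connected₄-or-obstruction : ∀ {n} (K : Graph n) → Connectedₖ 4 K ⊎ Obstruction K
connected₄-or-obstruction {n} K with 4 <? order K
... | no small = inj₂ (inj₁ (≮⇒≥ small))
... | yes large with all-or-counterexample n respects decide
  where
  P Q : (Fin n → Bool) → Set
  P X = # (λ u → X u ∧ V K u) < 4 → Connected (K ─ X)
  Q X = # (λ u → X u ∧ V K u) < 4 × Disconnection (K ─ X)
  respects : ∀ {X Y} → (∀ i → X i ≡ Y i) → P X → P Y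
  respects {X} {Y} X≗Y conn lt u v vu vv =
    Reach-map adj (conn (subst (_< 4) (sym size) lt) u v (transport vu) (transport vv))
    where
    size : # (λ u → X u ∧ V K u) ≡ # (λ u → Y u ∧ V K u)
    size = trans (#≡count (λ u → X u ∧ V K u))
             (trans (count-cong (λ u → cong (_∧ V K u) (X≗Y u))) (sym (#≡count (λ u → Y u ∧ V K u))))
    transport : ∀ {u} → V (K ─ Y) u ≡ true → V (K ─ X) u ≡ true
    transport {u} e rewrite X≗Y u = e
    adj : ∀ {u w} → Adj (K ─ X) u w ≡ true → Adj (K ─ Y) u w ≡ true
    adj {u} {w} e rewrite X≗Y u | X≗Y w = e
  decide : ∀ X → P X ⊎ Q X
  decide X with # (λ u → X u ∧ V K u) <? 4
  ... | no big = inj₁ λ lt → ⊥-elim (big lt)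
  ... | yes lt with connected-or-disconnected (K ─ X)
  ...   | inj₁ conn = inj₁ λ _ → conn
  ...   | inj₂ cut = inj₂ (lt , cut)
... | inj₁ all = inj₁ (large , all)
... | inj₂ (X , obstruction) = inj₂ (inj₂ (X , obstruction))

ClosedOutside : ∀ {n} → Graph n → (T U : Fin n → Bool) → Set
ClosedOutside G T U = ∀ {p q} → U p ≡ true → V G q ≡ true → T q ≡ false → E G p q ≡ true → U q ≡ true

separator≥4 : ∀ {n} {G : Graph n} → Connectedₖ 4 G → (T U : Fin n → Bool) → ClosedOutside G T U →
  ∀ {u w} → U u ≡ true → V G u ≡ true → T u ≡ false → V G w ≡ true → T w ≡ false → U w ≡ false →
  4 ≤ count (λ v → T v ∧ V G v)
separator≥4 {G = G} (_ , conn) T U closed {u} {w} uu vu tu vw tw uw with 4 ≤? count (λ v → T v ∧ V G v)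
... | yes big = big
... | no small = ⊥-elim (true≢false (stays uu (conn T lt u w (∧⁺ vu (not-false tu)) (∧⁺ vw (not-false tw)))) uw)
  where
  lt : # (λ v → T v ∧ V G v) < 4
  lt = subst (_< 4) (sym (#≡count (λ v → T v ∧ V G v))) (≰⇒> small)
  stays : ∀ {a b} → U a ≡ true → Reach (G ─ T) a b → U b ≡ true
  stays ua here = ua
  stays {a} ua (step {w = q} adj r) =
    stays (closed ua (∧⁻ˡ vq) (not-true (∧⁻ʳ {V G q} vq)) (Adj-E (G ─ T) adj)) r
    where
    vq = Adj-Vʳ (G ─ T) adj

deg≥4 : ∀ {n} {G : Graph n} → Simple G → Connectedₖ 4 G → ∀ {v} → V G v ≡ true → 4 ≤ count (Adj G v)
deg≥4 {n} {G} simple c4 {v} vv with 4 ≤? count (Adj G v)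
... | yes big = big
... | no small = ⊥-elim (<-irrefl refl (≤-trans separated
                   (≤-trans (count-mono {p = λ u → Adj G v u ∧ V G u} {q = Adj G v} (λ _ → ∧⁻ˡ)) (≤-pred (≰⇒> small)))))
  where
  Far : Fin n → Bool
  Far q = V G q ∧ not (Adj G v q) ∧ not (q =ᵛ v)
  order≤ : count (V G) ≤ count (Adj G v) + (1 + count Far)
  order≤ = ≤-trans (count-mono cover) (≤-trans (count-∨ (Adj G v) _) (+-monoʳ-≤ (count (Adj G v))
             (≤-trans (count-∨ (_=ᵛ v) Far) (+-monoˡ-≤ (count Far) (count-=ᵛ v)))))
    where
    cover : ∀ q → V G q ≡ true → Adj G v q ∨ ((q =ᵛ v) ∨ Far q) ≡ true
    cover q vq with true-or-false (Adj G v q) | true-or-false (q =ᵛ v)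
    ... | inj₁ adj | _ = ∨⁺ˡ adj
    ... | inj₂ _ | inj₁ q≡v = ∨⁺ʳ {Adj G v q} (∨⁺ˡ q≡v)
    ... | inj₂ nadj | inj₂ q≢v = ∨⁺ʳ {Adj G v q} (∨⁺ʳ {q =ᵛ v} (∧⁺ vq (∧⁺ (not-false nadj) (not-false q≢v))))
  some-far : 1 ≤ count Far
  some-far = +-cancelˡ-≤ 4 1 (count Far) (≤-trans (subst (4 <_) (#≡count (V G)) (proj₁ c4))
               (≤-trans order≤ (+-monoˡ-≤ (1 + count Far) (≤-pred (≰⇒> small)))))
  w = proj₁ (1≤count⇒∃ Far some-far)
  far-w = proj₂ (1≤count⇒∃ Far some-far)
  not-loop : Adj G v v ≡ false
  not-loop with true-or-false (Adj G v v)
  ... | inj₂ f = f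
  ... | inj₁ t = ⊥-elim (true≢false (Adj-E G t) (Simple.irr simple v))
  only-v : ClosedOutside G (Adj G v) (_=ᵛ v)
  only-v p≡v vq nadj e with =ᵛ-sound p≡v
  ... | refl = ⊥-elim (true≢false (Adj⁺ G vv vq e) nadj)
  separated = separator≥4 c4 (Adj G v) (_=ᵛ v) only-v (=ᵛ-refl v) vv not-loop (∧⁻ˡ far-w)
    (not-true (∧⁻ˡ (∧⁻ʳ {V G w} far-w))) (not-true (∧⁻ʳ {not (Adj G v w)} (∧⁻ʳ {V G w} far-w)))

joins : ∀ {n} → Fin n → Fin n → Fin n → Fin n → Bool
joins a b p q = (p =ᵛ a ∧ q =ᵛ b) ∨ (p =ᵛ b ∧ q =ᵛ a)

both-=ᵛ-false : ∀ {n} {p a q b : Fin n} → ¬ (p ≡ a × q ≡ b) → (p =ᵛ a ∧ q =ᵛ b) ≡ false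
both-=ᵛ-false {p = p} {a} {q} {b} h with true-or-false (p =ᵛ a)
... | inj₂ f = cong (_∧ (q =ᵛ b)) f
... | inj₁ t = trans (cong (_∧ (q =ᵛ b)) t) (=ᵛ-≢ (λ q≡b → h (=ᵛ-sound t , q≡b)))

joins-false : ∀ {n} {a b p q : Fin n} → ¬ (p ≡ a × q ≡ b) → ¬ (p ≡ b × q ≡ a) → joins a b p q ≡ false
joins-false h₁ h₂ = ∨-false (both-=ᵛ-false h₁) (both-=ᵛ-false h₂)

joins-true : ∀ {n} {a b p q : Fin n} → joins a b p q ≡ true → (p ≡ a × q ≡ b) ⊎ (p ≡ b × q ≡ a)
joins-true {a = a} {b} {p} {q} e with ∨⁻ {p =ᵛ a ∧ q =ᵛ b} e
... | inj₁ ab = inj₁ (=ᵛ-sound (∧⁻ˡ ab) , =ᵛ-sound (∧⁻ʳ {p =ᵛ a} ab))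
... | inj₂ ba = inj₂ (=ᵛ-sound (∧⁻ˡ ba) , =ᵛ-sound (∧⁻ʳ {p =ᵛ b} ba))

module _ {n : ℕ} (G : Graph n) (a b : Fin n) where

  deleteEdge-E : ∀ {p q} → joins a b p q ≡ false → E (deleteEdge G a b) p q ≡ E G p q
  deleteEdge-E {p} {q} e = trans (cong (λ t → E G p q ∧ not t) e) (∧-identityʳ (E G p q))

  deleteEdge-Adj⊆ : ∀ {p q} → Adj (deleteEdge G a b) p q ≡ true → Adj G p q ≡ true
  deleteEdge-Adj⊆ {p} {q} e =
    Adj⁺ G (Adj-Vˡ (deleteEdge G a b) e) (Adj-Vʳ (deleteEdge G a b) e) (∧⁻ˡ {E G p q} (Adj-E (deleteEdge G a b) e))

  lost-edge : ∀ {p q} → Adj G p q ≡ true → Adj (deleteEdge G a b) p q ≡ false → joins a b p q ≡ true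
  lost-edge {p} {q} adj nadj with true-or-false (joins a b p q)
  ... | inj₁ t = t
  ... | inj₂ f = ⊥-elim (true≢false (subst (λ t → V G p ∧ V G q ∧ t ≡ true) (sym (deleteEdge-E f)) adj) nadj)

  deg-deleteEdge : ∀ v w → (∀ {u} → joins a b v u ≡ true → u ≡ w) →
    count (Adj G v) ≤ count (Adj (deleteEdge G a b) v) + 1
  deg-deleteEdge v w lost≡w = begin
    count (Adj G v)                                          ≤⟨ count-mono kept-or-w ⟩
    count (λ u → Adj (deleteEdge G a b) v u ∨ (u =ᵛ w))      ≤⟨ count-∨ (Adj (deleteEdge G a b) v) (_=ᵛ w) ⟩
    count (Adj (deleteEdge G a b) v) + count (_=ᵛ w)         ≤⟨ +-monoʳ-≤ _ (count-=ᵛ w) ⟩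
    count (Adj (deleteEdge G a b) v) + 1                     ∎
    where
    open ≤-Reasoning
    kept-or-w : ∀ u → Adj G v u ≡ true → Adj (deleteEdge G a b) v u ∨ (u =ᵛ w) ≡ true
    kept-or-w u adj with true-or-false (Adj (deleteEdge G a b) v u)
    ... | inj₁ kept = ∨⁺ˡ kept
    ... | inj₂ lost = ∨⁺ʳ {Adj (deleteEdge G a b) v u} (subst (λ t → u =ᵛ t ≡ true) (lost≡w (lost-edge adj lost)) (=ᵛ-refl u))

  deg-deleteEdgeˡ : count (Adj G a) ≤ count (Adj (deleteEdge G a b) a) + 1
  deg-deleteEdgeˡ = deg-deleteEdge a b λ j → [ proj₂ , (λ where (a≡b , u≡a) → trans u≡a a≡b) ]′ (joins-true {a = a} {b} j)

  deg-deleteEdgeʳ : count (Adj G b) ≤ count (Adj (deleteEdge G a b) b) + 1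
  deg-deleteEdgeʳ = deg-deleteEdge b a λ j → [ (λ where (b≡a , u≡b) → trans u≡b b≡a) , proj₂ ]′ (joins-true {a = a} {b} j)

module SimpleGraph {n : ℕ} {G : Graph n} (simple : Simple G) where

  E-sym : ∀ {p q} → E G p q ≡ true → E G q p ≡ true
  E-sym {p} {q} e = trans (Simple.sym simple q p) e

  E-Vˡ : ∀ {p q} → E G p q ≡ true → V G p ≡ true
  E-Vˡ {p} {q} = Simple.inV simple p q

  E-Vʳ : ∀ {p q} → E G p q ≡ true → V G q ≡ true
  E-Vʳ e = E-Vˡ (E-sym e)

  E-≢ : ∀ {p q} → E G p q ≡ true → p ≢ q
  E-≢ {p} e refl = true≢false e (Simple.irr simple p)

-- Near-separations from non-removable edges

-- A separation (A, S, V ∖ (A ∪ S)) of G − xy; b is a vertex of the far side other than y.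
record NearSeparation {n : ℕ} (G : Graph n) (x y z : Fin n) : Set where
  field
    S A : Fin n → Bool
    |S|≤3 : count (λ u → S u ∧ V G u) ≤ 3
    A⊆V : ∀ {u} → A u ≡ true → V G u ≡ true
    A∩S=∅ : ∀ {u} → A u ≡ true → S u ≡ false
    x∈A : A x ≡ true
    y∉A : A y ≡ false
    y∉S : S y ≡ false
    z∈S : S z ≡ true
    only-xy : ∀ {u v} → A u ≡ true → V G v ≡ true → S v ≡ false → A v ≡ false → E G u v ≡ true → u ≡ x × v ≡ y
    b : Fin n
    b∈V : V G b ≡ true
    b∉S : S b ≡ false
    b∉A : A b ≡ false
    b≢y : b ≢ y

module NonRemovable {n : ℕ} {G : Graph n} (simple : Simple G) (c4 : Connectedₖ 4 G) (order≥7 : 7 ≤ order G)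
  {x y z : Fin n} (xy : E G x y ≡ true) (yz : E G y z ≡ true) (xz : E G x z ≡ true) (deg-x : 5 ≤ deg G x) where

  open SimpleGraph simple

  H : Graph n
  H = deleteEdge G x y

  K : Graph n
  K = G ⊖ (x , y)

  degree-3 : Fin n → Bool
  degree-3 v = deg H v ≡ᵇ 3

  x≢y : x ≢ y
  x≢y = E-≢ xy

  x≢z : x ≢ z
  x≢z = E-≢ xz

  y≢z : y ≢ z
  y≢z = E-≢ yz

  H-E : ∀ {p q} → ¬ (p ≡ x × q ≡ y) → ¬ (p ≡ y × q ≡ x) → E G p q ≡ true → E H p q ≡ true
  H-E h₁ h₂ e = trans (deleteEdge-E G x y (joins-false h₁ h₂)) e

  degree-3⇒ : ∀ {v} → degree-3 v ≡ true → count (Adj H v) ≡ 3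
  degree-3⇒ {v} t = trans (sym (#≡count (Adj H v))) (≡ᵇ⇒≡ _ 3 (subst T (sym t) _))

  degree-3⇐ : ∀ {v} → count (Adj H v) ≡ 3 → degree-3 v ≡ true
  degree-3⇐ {v} e = cong (_≡ᵇ 3) (trans (#≡count (Adj H v)) e)

  x-not-degree-3 : degree-3 x ≡ false
  x-not-degree-3 with true-or-false (degree-3 x)
  ... | inj₂ f = f
  ... | inj₁ t = ⊥-elim (<-irrefl refl (≤-trans deg-H-x (≤-reflexive (degree-3⇒ t))))
    where
    deg-H-x : 4 ≤ count (Adj H x)
    deg-H-x = +-cancelʳ-≤ 1 4 _ (≤-trans (subst (5 ≤_) (#≡count (Adj G x)) deg-x) (deg-deleteEdgeˡ G x y))

  V-K : ∀ u → V K u ≡ V G u ∧ not (u =ᵛ y ∧ degree-3 y)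
  V-K u = cong (λ t → V G u ∧ not (t ∨ (u =ᵛ y ∧ degree-3 y)))
            (trans (cong ((u =ᵛ x) ∧_) x-not-degree-3) (∧-zeroʳ (u =ᵛ x)))

  N : Fin n → Bool
  N = Adj H y

  N-≢x : ∀ {q} → N q ≡ true → q ≢ x
  N-≢x a refl = true≢false (Adj-E H a) (trans (cong (λ t → E G y x ∧ not t) yx-joins) (∧-zeroʳ (E G y x)))
    where
    yx-joins : joins x y y x ≡ true
    yx-joins = ∨⁺ʳ {y =ᵛ x ∧ x =ᵛ y} (∧⁺ (=ᵛ-refl y) (=ᵛ-refl x))

  N⁺ : ∀ {q} → E G y q ≡ true → q ≢ x → N q ≡ true
  N⁺ e q≢x = Adj⁺ H (E-Vˡ e) (E-Vʳ e) (H-E (λ p → x≢y (sym (proj₁ p))) (λ p → q≢x (proj₂ p)) e)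

  N-E : ∀ {q} → N q ≡ true → E G q y ≡ true
  N-E a = E-sym (Adj-E G (deleteEdge-Adj⊆ G x y a))

  N-V : ∀ {q} → N q ≡ true → V G q ≡ true
  N-V a = Adj-Vʳ H a

  y∉N : N y ≡ false
  y∉N with true-or-false (N y)
  ... | inj₂ f = f
  ... | inj₁ t = ⊥-elim (E-≢ (N-E t) refl)

  N≥4 : degree-3 y ≡ false → 4 ≤ count N
  N≥4 not-3 = ≤∧≢⇒< N≥3 λ 3≡N → true≢false (degree-3⇐ (sym 3≡N)) not-3
    where
    N≥3 : 3 ≤ count N
    N≥3 = +-cancelʳ-≤ 1 3 _ (≤-trans (deg≥4 simple c4 (E-Vʳ xy)) (deg-deleteEdgeʳ G x y))

  order-K : 4 < order K
  order-K = +-cancelʳ-≤ 2 5 _ (begin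
    7                                             ≤⟨ subst (7 ≤_) (#≡count (V G)) order≥7 ⟩
    count (V G)                                   ≤⟨ count-mono cover ⟩
    count (λ u → V K u ∨ ((u =ᵛ x) ∨ (u =ᵛ y)))    ≤⟨ count-∨ (V K) _ ⟩
    count (V K) + count (λ u → (u =ᵛ x) ∨ (u =ᵛ y)) ≤⟨ +-monoʳ-≤ (count (V K)) ends ⟩
    count (V K) + 2                               ≡⟨ cong (_+ 2) (sym (#≡count (V K))) ⟩
    order K + 2                                   ∎)
    where
    open ≤-Reasoning
    ends : count (λ u → (u =ᵛ x) ∨ (u =ᵛ y)) ≤ 2
    ends = ≤-trans (count-∨ (_=ᵛ x) (_=ᵛ y)) (+-mono-≤ (count-=ᵛ x) (count-=ᵛ y))
    cover : ∀ u → V G u ≡ true → V K u ∨ ((u =ᵛ x) ∨ (u =ᵛ y)) ≡ true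
    cover u vu with true-or-false (u =ᵛ y)
    ... | inj₁ u≡y = ∨⁺ʳ {V K u} (∨⁺ʳ {u =ᵛ x} u≡y)
    ... | inj₂ u≢y = ∨⁺ˡ (trans (V-K u) (trans (cong (λ t → V G u ∧ not (t ∧ degree-3 y)) u≢y) (trans (∧-identityʳ (V G u)) vu)))

  module Cut (X : Fin n → Bool) (small : # (λ u → X u ∧ V K u) < 4) (cut : Disconnection (K ─ X)) where
    open Disconnection cut renaming (part to C)

    W : Fin n → Bool
    W = V (K ─ X)

    D : Fin n → Bool
    D u = W u ∧ not (C u)

    |X|≤3 : count (λ u → X u ∧ V K u) ≤ 3
    |X|≤3 = ≤-pred (subst (_< 4) (#≡count (λ u → X u ∧ V K u)) small)

    W-X : ∀ {u} → W u ≡ true → X u ≡ false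
    W-X {u} w = not-true (∧⁻ʳ {V K u} w)

    -- Closedness along edges present in both directions suffices and avoids proving G ⊖ xy symmetric.
    TwoWayClosed : (Fin n → Bool) → Set
    TwoWayClosed Y = ∀ {p q} → Y p ≡ true → W q ≡ true → Adj (K ─ X) p q ≡ true → Adj (K ─ X) q p ≡ true → Y q ≡ true

    C-closed : TwoWayClosed C
    C-closed cp _ a _ = closed cp a

    D-closed : TwoWayClosed D
    D-closed {p} {q} dp wq _ a with true-or-false (C q)
    ... | inj₂ f = ∧⁺ wq (not-false f)
    ... | inj₁ t = ⊥-elim (true≢false (closed t a) (not-true (∧⁻ʳ {W p} dp)))

    D⁺ : ∀ {u} → W u ≡ true → C u ≡ false → D u ≡ true
    D⁺ w c = ∧⁺ w (not-false c)

    D-W : ∀ {u} → D u ≡ true → W u ≡ true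
    D-W = ∧⁻ˡ

    C∉D : ∀ {u} → C u ≡ true → D u ≡ false
    C∉D {u} c = trans (cong (λ t → W u ∧ not t) c) (∧-zeroʳ (W u))

    D∉C : ∀ {u} → D u ≡ true → C u ≡ false
    D∉C {u} d = not-true (∧⁻ʳ {W u} d)

    old-edge : ∀ {p q} → W p ≡ true → W q ≡ true → joins x y p q ≡ false → E G p q ≡ true → Adj (K ─ X) p q ≡ true
    old-edge {p} {q} wp wq j e =
      Adj⁺ (K ─ X) wp wq (∧⁺ (∧⁻ˡ {V K p} wp) (∧⁺ (∧⁻ˡ {V K q} wq) (∨⁺ˡ (trans (deleteEdge-E G x y j) e))))

    module YKept (kept : degree-3 y ≡ false) where

      V-K-kept : ∀ u → V K u ≡ V G u
      V-K-kept u = trans (V-K u) (trans (cong (λ t → V G u ∧ not ((u =ᵛ y) ∧ t)) kept)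
                     (trans (cong (λ t → V G u ∧ not t) (∧-zeroʳ (u =ᵛ y))) (∧-identityʳ (V G u))))

      W-V : ∀ {u} → W u ≡ true → V G u ≡ true
      W-V {u} w = trans (sym (V-K-kept u)) (∧⁻ˡ w)

      W⁺ : ∀ {u} → V G u ≡ true → X u ≡ false → W u ≡ true
      W⁺ {u} v f = ∧⁺ (trans (V-K-kept u) v) (not-false f)

      |X∩V|≤3 : count (λ u → X u ∧ V G u) ≤ 3
      |X∩V|≤3 = subst (_≤ 3) (count-cong (λ u → cong (X u ∧_) (V-K-kept u))) |X|≤3

      module _ (Y : Fin n → Bool) (Y⊆W : ∀ {u} → Y u ≡ true → W u ≡ true) (Y-closed : TwoWayClosed Y)
        (x∈Y : Y x ≡ true) (y∈W : W y ≡ true) (y∉Y : Y y ≡ false) where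

        Y-edge : ∀ {p q} → Y p ≡ true → W q ≡ true → ¬ (p ≡ x × q ≡ y) → ¬ (p ≡ y × q ≡ x) → E G p q ≡ true →
          Y q ≡ true
        Y-edge yp wq h₁ h₂ e = Y-closed yp wq (old-edge (Y⊆W yp) wq (joins-false h₁ h₂) e)
          (old-edge wq (Y⊆W yp) (joins-false (λ (q≡x , p≡y) → h₂ (p≡y , q≡x)) (λ (q≡y , p≡x) → h₁ (p≡x , q≡y))) (E-sym e))

        not-from-y : ∀ {p q} → Y p ≡ true → ¬ (p ≡ y × q ≡ x)
        not-from-y yp (p≡y , _) = member-≢ Y yp y∉Y p≡y

        side : NearSeparation G x y z
        side = record
          { S = X ; A = Y ; |S|≤3 = |X∩V|≤3 ; A⊆V = W-V ∘ Y⊆W ; A∩S=∅ = W-X ∘ Y⊆W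
          ; x∈A = x∈Y ; y∉A = y∉Y ; y∉S = W-X y∈W ; z∈S = z∈X ; only-xy = only-xy
          ; b = b ; b∈V = W-V b∈W ; b∉S = W-X b∈W ; b∉A = b∉Y ; b≢y = member-≢ N Nb y∉N }
          where
          z∈X : X z ≡ true
          z∈X with true-or-false (X z)
          ... | inj₁ t = t
          ... | inj₂ f with true-or-false (Y z)
          ...   | inj₁ z∈Y = ⊥-elim (true≢false
                  (Y-edge z∈Y y∈W (λ (z≡x , _) → x≢z (sym z≡x)) (λ (z≡y , _) → y≢z (sym z≡y)) (E-sym yz)) y∉Y)
          ...   | inj₂ z∉Y = ⊥-elim (true≢false
                  (Y-edge x∈Y (W⁺ (E-Vʳ xz) f) (λ (_ , z≡y) → y≢z (sym z≡y)) (λ (x≡y , _) → x≢y x≡y) xz) z∉Y)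
          only-xy : ∀ {u v} → Y u ≡ true → V G v ≡ true → X v ≡ false → Y v ≡ false → E G u v ≡ true → u ≡ x × v ≡ y
          only-xy {u} {v} yu vv xv v∉Y e with u ≟ x | v ≟ y
          ... | yes u≡x | yes v≡y = u≡x , v≡y
          ... | no u≢x | _ = ⊥-elim (true≢false (Y-edge yu (W⁺ vv xv) (λ (u≡x , _) → u≢x u≡x) (not-from-y yu) e) v∉Y)
          ... | yes _ | no v≢y = ⊥-elim (true≢false (Y-edge yu (W⁺ vv xv) (λ (_ , v≡y) → v≢y v≡y) (not-from-y yu) e) v∉Y)
          escaped = count-escape N (λ u → X u ∧ V G u) (≤-trans (s≤s |X∩V|≤3) (N≥4 kept))
          b = proj₁ escaped
          Nb = proj₁ (proj₂ escaped)
          b∈W : W b ≡ true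
          b∈W with true-or-false (X b)
          ... | inj₂ f = W⁺ (N-V Nb) f
          ... | inj₁ t = ⊥-elim (true≢false (∧⁺ t (N-V Nb)) (proj₂ (proj₂ escaped)))
          b∉Y : Y b ≡ false
          b∉Y with true-or-false (Y b)
          ... | inj₂ f = f
          ... | inj₁ t = ⊥-elim (true≢false (Y-edge t y∈W (λ (b≡x , _) → N-≢x Nb b≡x) (not-from-y t) (N-E Nb)) y∉Y)

      -- By 4-connectivity, C cannot be closed in G − X, so xy joins C to the rest of K − X.
      crossed : ¬ (∀ {p q} → C p ≡ true → W q ≡ true → C q ≡ false → (p ≡ x × q ≡ y) ⊎ (p ≡ y × q ≡ x) → ⊥)
      crossed no-cross = <-irrefl refl (≤-trans sep |X∩V|≤3)
        where
        closed-outside : ClosedOutside G X C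
        closed-outside {p} {q} cp vq xq e with true-or-false (C q) | true-or-false (joins x y p q)
        ... | inj₁ cq | _ = cq
        ... | inj₂ cq | inj₁ j = ⊥-elim (no-cross cp (W⁺ vq xq) cq (joins-true {a = x} {y} {p} {q} j))
        ... | inj₂ cq | inj₂ j = closed cp (old-edge (part⊆V cp) (W⁺ vq xq) j e)
        sep = separator≥4 c4 X C closed-outside inside∈ (W-V (part⊆V inside∈)) (W-X (part⊆V inside∈))
                (W-V outside∈V) (W-X outside∈V) outside∉

      nearSeparation : NearSeparation G x y z
      nearSeparation with true-or-false (C x) | true-or-false (C y)
      ... | inj₁ cx | inj₁ cy = ⊥-elim (crossed λ _ _ cq → [ (λ (_ , q≡y) → member-≢ C cy cq (sym q≡y))
                                                            , (λ (_ , q≡x) → member-≢ C cx cq (sym q≡x)) ]′)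
      ... | inj₂ cx | inj₂ cy = ⊥-elim (crossed λ cp _ _ → [ (λ (p≡x , _) → member-≢ C cp cx p≡x)
                                                            , (λ (p≡y , _) → member-≢ C cp cy p≡y) ]′)
      ... | inj₁ cx | inj₂ cy with true-or-false (X y)
      ...   | inj₂ y∉X = side C part⊆V C-closed cx (W⁺ (E-Vʳ xy) y∉X) cy
      ...   | inj₁ y∈X = ⊥-elim (crossed λ cp wq _ → [ (λ (_ , q≡y) → true≢false (subst (λ t → X t ≡ true) (sym q≡y) y∈X) (W-X wq))
                                                      , (λ (p≡y , _) → member-≢ C cp cy p≡y) ]′)
      nearSeparation | inj₂ cx | inj₁ cy with true-or-false (X x)
      ...   | inj₂ x∉X = side D D-W D-closed (D⁺ (W⁺ (E-Vˡ xy) x∉X) cx) (part⊆V cy) (C∉D cy)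
      ...   | inj₁ x∈X = ⊥-elim (crossed λ cp wq _ → [ (λ (p≡x , _) → member-≢ C cp cx p≡x)
                                                      , (λ (_ , q≡x) → true≢false (subst (λ t → X t ≡ true) (sym q≡x) x∈X) (W-X wq)) ]′)

    module YRemoved (removed : degree-3 y ≡ true) where

      V-K-removed : ∀ u → V K u ≡ V G u ∧ not (u =ᵛ y)
      V-K-removed u = trans (V-K u) (cong (λ t → V G u ∧ not t) (trans (cong ((u =ᵛ y) ∧_) removed) (∧-identityʳ (u =ᵛ y))))

      W-V : ∀ {u} → W u ≡ true → V G u ≡ true
      W-V {u} w = ∧⁻ˡ (trans (sym (V-K-removed u)) (∧⁻ˡ {V K u} w))

      W-≢y : ∀ {u} → W u ≡ true → u ≢ y
      W-≢y {u} w = =ᵛ-false (not-true (∧⁻ʳ {V G u} (trans (sym (V-K-removed u)) (∧⁻ˡ {V K u} w))))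

      W⁺ : ∀ {u} → V G u ≡ true → u ≢ y → X u ≡ false → W u ≡ true
      W⁺ {u} v u≢y f = ∧⁺ (trans (V-K-removed u) (∧⁺ v (not-false (=ᵛ-≢ u≢y)))) (not-false f)

      edge : ∀ {p q} → W p ≡ true → W q ≡ true → E G p q ≡ true → Adj (K ─ X) p q ≡ true
      edge wp wq = old-edge wp wq (joins-false (λ (_ , q≡y) → W-≢y wq q≡y) (λ (p≡y , _) → W-≢y wp p≡y))

      clique : ∀ {p q} → W p ≡ true → W q ≡ true → p ≢ q → N p ≡ true → N q ≡ true → Adj (K ─ X) p q ≡ true
      clique {p} {q} wp wq p≢q np nq = Adj⁺ (K ─ X) wp wq (∧⁺ (∧⁻ˡ {V K p} wp) (∧⁺ (∧⁻ˡ {V K q} wq)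
        (∨⁺ʳ {E H p q} (∧⁺ (not-false (=ᵛ-≢ p≢q))
          (∨⁺ʳ {degree-3 x ∧ Adj H x p ∧ Adj H x q} (∧⁺ removed (∧⁺ np nq)))))))

      S : Fin n → Bool
      S u = X u ∧ not (u =ᵛ y)

      |S∩V|≤3 : count (λ u → S u ∧ V G u) ≤ 3
      |S∩V|≤3 = subst (_≤ 3) (count-cong same) |X|≤3
        where
        same : ∀ u → X u ∧ V K u ≡ S u ∧ V G u
        same u = trans (cong (X u ∧_) (trans (V-K-removed u) (∧-comm (V G u) _))) (sym (∧-assoc (X u) _ (V G u)))

      W-S : ∀ {u} → W u ≡ true → S u ≡ false
      W-S {u} w = cong (_∧ not (u =ᵛ y)) (W-X w)

      X-from-S : ∀ {v} → S v ≡ false → v ≢ y → X v ≡ false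
      X-from-S {v} e v≢y = trans (sym (∧-identityʳ (X v))) (trans (cong (λ t → X v ∧ not t) (sym (=ᵛ-≢ v≢y))) e)

      module _ (Y : Fin n → Bool) (Y⊆W : ∀ {u} → Y u ≡ true → W u ≡ true) (Y-closed : TwoWayClosed Y) where

        Y-edge : ∀ {p q} → Y p ≡ true → W q ≡ true → E G p q ≡ true → Y q ≡ true
        Y-edge yp wq e = Y-closed yp wq (edge (Y⊆W yp) wq e) (edge wq (Y⊆W yp) (E-sym e))

        -- Since N(y) − x is a clique of K, a side avoiding one such neighbour avoids them all.
        N-free : ∀ {p} → W p ≡ true → Y p ≡ false → N p ≡ true → ∀ {q} → Y q ≡ true → N q ≡ true → ⊥
        N-free wp p∉Y np yq nq =
          true≢false (Y-closed yq wp (clique (Y⊆W yq) wp q≢p nq np) (clique wp (Y⊆W yq) (q≢p ∘ sym) np nq)) p∉Y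
          where
          q≢p = member-≢ Y yq p∉Y

        touches-y : ∀ {u w} → Y u ≡ true → W w ≡ true → Y w ≡ false → ∃ λ p → Y p ≡ true × E G p y ≡ true
        touches-y {u} {w} yu ww yw with any? (λ p → (Y p ∧ E G p y) ≟ᵇ true)
        ... | yes (p , e) = p , ∧⁻ˡ e , ∧⁻ʳ {Y p} e
        ... | no none = ⊥-elim (<-irrefl refl (≤-trans sep |S∩V|≤3))
          where
          closed-outside : ClosedOutside G S Y
          closed-outside {p} {q} yp vq sq e with true-or-false (q =ᵛ y)
          ... | inj₁ q≡y = ⊥-elim (none (p , ∧⁺ yp (subst (λ t → E G p t ≡ true) (=ᵛ-sound q≡y) e)))
          ... | inj₂ q≢y = Y-edge yp (W⁺ vq (=ᵛ-false q≢y) (X-from-S sq (=ᵛ-false q≢y))) e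
          sep = separator≥4 c4 S Y closed-outside yu (W-V (Y⊆W yu)) (W-S (Y⊆W yu)) (W-V ww) (W-S ww) yw

        side : Y x ≡ true → (∀ {q} → Y q ≡ true → N q ≡ true → ⊥) → ∀ {b} → W b ≡ true → Y b ≡ false →
          NearSeparation G x y z
        side x∈Y no-N {b} b∈W b∉Y = record
          { S = S ; A = Y ; |S|≤3 = |S∩V|≤3 ; A⊆V = W-V ∘ Y⊆W ; A∩S=∅ = W-S ∘ Y⊆W
          ; x∈A = x∈Y ; y∉A = y∉Y ; y∉S = trans (cong (λ t → X y ∧ not t) (=ᵛ-refl y)) (∧-zeroʳ (X y))
          ; z∈S = z∈S ; only-xy = only-xy
          ; b = b ; b∈V = W-V b∈W ; b∉S = W-S b∈W ; b∉A = b∉Y ; b≢y = W-≢y b∈W }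
          where
          y∉Y : Y y ≡ false
          y∉Y with true-or-false (Y y)
          ... | inj₂ f = f
          ... | inj₁ t = ⊥-elim (W-≢y (Y⊆W t) refl)
          z∈S : S z ≡ true
          z∈S with true-or-false (X z)
          ... | inj₁ t = ∧⁺ t (not-false (=ᵛ-≢ (y≢z ∘ sym)))
          ... | inj₂ f = ⊥-elim (no-N (Y-edge x∈Y (W⁺ (E-Vʳ xz) (y≢z ∘ sym) f) xz) (N⁺ yz (x≢z ∘ sym)))
          only-xy : ∀ {u v} → Y u ≡ true → V G v ≡ true → S v ≡ false → Y v ≡ false → E G u v ≡ true → u ≡ x × v ≡ y
          only-xy {u} {v} yu vv sv v∉Y e with true-or-false (v =ᵛ y)
          ... | inj₂ v≢y = ⊥-elim (true≢false (Y-edge yu (W⁺ vv (=ᵛ-false v≢y) (X-from-S sv (=ᵛ-false v≢y))) e) v∉Y)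
          ... | inj₁ v≡y with u ≟ x
          ...   | yes u≡x = u≡x , =ᵛ-sound v≡y
          ...   | no u≢x = ⊥-elim (no-N yu (N⁺ (E-sym (subst (λ t → E G u t ≡ true) (=ᵛ-sound v≡y) e)) u≢x))

      touch-C = touches-y C part⊆V C-closed inside∈ outside∈V outside∉
      touch-D = touches-y D D-W D-closed (D⁺ outside∈V outside∉) (part⊆V inside∈) (C∉D inside∈)

      pC = proj₁ touch-C
      pC∈C = proj₁ (proj₂ touch-C)
      pD = proj₁ touch-D
      pD∈D = proj₁ (proj₂ touch-D)

      N-pD : pD ≢ x → N pD ≡ true
      N-pD = N⁺ (E-sym (proj₂ (proj₂ touch-D)))

      nearSeparation : NearSeparation G x y z
      nearSeparation with true-or-false (C x)
      ... | inj₁ cx = side C part⊆V C-closed cx (N-free C part⊆V C-closed (D-W pD∈D) (D∉C pD∈D) (N-pD pD≢x)) (D-W pD∈D) (D∉C pD∈D)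
        where
        pD≢x : pD ≢ x
        pD≢x pD≡x = member-≢ C cx (D∉C pD∈D) (sym pD≡x)
      ... | inj₂ cx = side D D-W D-closed x∈D (N-free D D-W D-closed (part⊆V pC∈C) (C∉D pC∈C) N-pC) (part⊆V pC∈C) (C∉D pC∈C)
        where
        N-pC : N pC ≡ true
        N-pC = N⁺ (E-sym (proj₂ (proj₂ touch-C))) (member-≢ C pC∈C cx)
        x∈D : D x ≡ true
        x∈D with pD ≟ x
        ... | yes pD≡x = subst (λ t → D t ≡ true) pD≡x pD∈D
        ... | no pD≢x = ⊥-elim (N-free C part⊆V C-closed (D-W pD∈D) (D∉C pD∈D) (N-pD pD≢x) pC∈C N-pC)

  nearSeparation : Obstruction K → NearSeparation G x y z
  nearSeparation (inj₁ small-order) = ⊥-elim (<⇒≱ order-K small-order)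
  nearSeparation (inj₂ (X , small , cut)) with true-or-false (degree-3 y)
  ... | inj₁ removed = Cut.YRemoved.nearSeparation X small cut removed
  ... | inj₂ kept = Cut.YKept.nearSeparation X small cut kept

-- Two near-separations at x

data Side : Set where
  near far : Side

opposite : Side → Side
opposite near = far
opposite far = near

module Sides {n : ℕ} {G : Graph n} (simple : Simple G) {x y z : Fin n} (P : NearSeparation G x y z) where
  open NearSeparation P public
  open SimpleGraph simple

  sep : Fin n → Bool
  sep u = S u ∧ V G u

  side : Side → Fin n → Bool
  side near = A
  side far u = V G u ∧ not (S u) ∧ not (A u)

  side-V : ∀ σ {u} → side σ u ≡ true → V G u ≡ true
  side-V near = A⊆V
  side-V far = ∧⁻ˡ

  side-S : ∀ σ {u} → side σ u ≡ true → S u ≡ false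
  side-S near = A∩S=∅
  side-S far {u} e = not-true (∧⁻ˡ (∧⁻ʳ {V G u} e))

  far-A : ∀ {u} → side far u ≡ true → A u ≡ false
  far-A {u} e = not-true (∧⁻ʳ {not (S u)} (∧⁻ʳ {V G u} e))

  far⁺ : ∀ {u} → V G u ≡ true → S u ≡ false → A u ≡ false → side far u ≡ true
  far⁺ v s a = ∧⁺ v (∧⁺ (not-false s) (not-false a))

  sep⁺ : ∀ {u} → S u ≡ true → V G u ≡ true → sep u ≡ true
  sep⁺ = ∧⁺

  side-sep : ∀ σ {u} → side σ u ≡ true → sep u ≡ false
  side-sep σ {u} e = cong (_∧ V G u) (side-S σ e)

  near-far : ∀ {u} → side near u ≡ true → side far u ≡ false
  near-far {u} a with true-or-false (side far u)
  ... | inj₂ f = f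
  ... | inj₁ t = ⊥-elim (true≢false a (far-A t))

  x∈near : side near x ≡ true
  x∈near = x∈A

  x∉far : side far x ≡ false
  x∉far with true-or-false (side far x)
  ... | inj₂ f = f
  ... | inj₁ t = ⊥-elim (true≢false x∈A (far-A t))

  y∈far : V G y ≡ true → side far y ≡ true
  y∈far v = far⁺ v y∉S y∉A

  b∈far : side far b ≡ true
  b∈far = far⁺ b∈V b∉S b∉A

  classify : ∀ {u} → V G u ≡ true → sep u ≡ true ⊎ side near u ≡ true ⊎ side far u ≡ true
  classify {u} v with true-or-false (S u) | true-or-false (A u)
  ... | inj₁ s | _ = inj₁ (sep⁺ s v)
  ... | inj₂ _ | inj₁ a = inj₂ (inj₁ a)
  ... | inj₂ s | inj₂ a = inj₂ (inj₂ (far⁺ v s a))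

  locate : ∀ σ {u} → V G u ≡ true → sep u ≡ true ⊎ side σ u ≡ true ⊎ side (opposite σ) u ≡ true
  locate near v = classify v
  locate far v with classify v
  ... | inj₁ s = inj₁ s
  ... | inj₂ (inj₁ a) = inj₂ (inj₂ a)
  ... | inj₂ (inj₂ f) = inj₂ (inj₁ f)

  crossing : ∀ σ {p q} → side σ p ≡ true → side (opposite σ) q ≡ true → E G p q ≡ true →
    (p ≡ x × q ≡ y) ⊎ (p ≡ y × q ≡ x)
  crossing near ap fq e = inj₁ (only-xy ap (side-V far fq) (side-S far fq) (far-A fq) e)
  crossing far fp aq e = inj₂ (swap (only-xy aq (side-V far fp) (side-S far fp) (far-A fp) (E-sym e)))

crossing-arithmetic : ∀ a₁ b₁ a₂ b₂ s → a₁ + b₁ + s ≤ 3 → a₂ + b₂ + s ≤ 3 → 3 ≤ a₁ + a₂ + s →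
  2 ≤ b₁ ⊎ 4 ≤ b₁ + a₂ + s ⊎ 4 ≤ b₁ + b₂ + s →
  2 ≤ b₂ ⊎ 4 ≤ a₁ + b₂ + s ⊎ 4 ≤ b₁ + b₂ + s → ⊥
crossing-arithmetic a₁ b₁ a₂ b₂ s sep₁ sep₂ inner = cases
  where
  open +-*-Solver
  regroup : ∀ a₁ b₁ a₂ b₂ s → (a₁ + a₂ + s) + (b₁ + b₂ + s) ≡ (a₁ + b₁ + s) + (a₂ + b₂ + s)
  regroup = solve 5 (λ a₁ b₁ a₂ b₂ s → (a₁ :+ a₂ :+ s) :+ (b₁ :+ b₂ :+ s) := (a₁ :+ b₁ :+ s) :+ (a₂ :+ b₂ :+ s)) refl
  separators : (a₁ + b₁ + s) + (a₂ + b₂ + s) ≤ 6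
  separators = +-mono-≤ sep₁ sep₂
  b₁+b₂+s≤3 : b₁ + b₂ + s ≤ 3
  b₁+b₂+s≤3 = +-cancelˡ-≤ 3 _ 3
    (≤-trans (+-monoˡ-≤ (b₁ + b₂ + s) inner) (≤-trans (≤-reflexive (regroup a₁ b₁ a₂ b₂ s)) separators))
  b₁+b₂+s≱4 : 4 ≤ b₁ + b₂ + s → ⊥
  b₁+b₂+s≱4 h = <-irrefl refl (≤-trans h b₁+b₂+s≤3)
  both-big : 2 ≤ b₁ → 2 ≤ b₂ → ⊥
  both-big h₁ h₂ = b₁+b₂+s≱4 (≤-trans (+-mono-≤ h₁ h₂) (m≤m+n (b₁ + b₂) s))
  mixed : 4 ≤ b₁ + a₂ + s → 4 ≤ a₁ + b₂ + s → ⊥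
  mixed h₁ h₂ =
    <⇒≱ (<ᵇ⇒< 6 8 _) (≤-trans (+-mono-≤ h₁ h₂) (≤-trans (≤-reflexive (regroup′ a₁ b₁ a₂ b₂ s)) separators))
    where
    regroup′ : ∀ a₁ b₁ a₂ b₂ s → (b₁ + a₂ + s) + (a₁ + b₂ + s) ≡ (a₁ + b₁ + s) + (a₂ + b₂ + s)
    regroup′ = solve 5 (λ a₁ b₁ a₂ b₂ s → (b₁ :+ a₂ :+ s) :+ (a₁ :+ b₂ :+ s) := (a₁ :+ b₁ :+ s) :+ (a₂ :+ b₂ :+ s)) refl
  -- b ≥ 2 leaves at most one vertex for a + s in that separator, forcing the other b′ ≥ 3.
  lopsided : ∀ a b b′ → a + b + s ≤ 3 → 2 ≤ b → 4 ≤ a + b′ + s → b + b′ + s ≤ 3 → ⊥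
  lopsided a b b′ sep big crowded b+b′+s≤3 =
    <⇒≱ (<ᵇ⇒< 3 5 _) (≤-trans (≤-trans (+-mono-≤ big b′≥3) (m≤m+n (b + b′) s)) b+b′+s≤3)
    where
    a+s≤1 : a + s ≤ 1
    a+s≤1 = +-cancelʳ-≤ 2 (a + s) 1 (≤-trans (+-monoʳ-≤ (a + s) big)
              (≤-trans (≤-reflexive (trans (+-assoc a s b) (trans (cong (a +_) (+-comm s b)) (sym (+-assoc a b s))))) sep))
    b′≥3 : 3 ≤ b′
    b′≥3 = +-cancelˡ-≤ 1 3 b′ (≤-trans crowded
              (≤-trans (≤-reflexive (trans (+-assoc a b′ s) (trans (cong (a +_) (+-comm b′ s)) (sym (+-assoc a s b′))))) (+-monoˡ-≤ b′ a+s≤1)))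
  swap-ends : ∀ p q → p + q + s ≡ q + p + s
  swap-ends p q = cong (_+ s) (+-comm p q)
  cases : 2 ≤ b₁ ⊎ 4 ≤ b₁ + a₂ + s ⊎ 4 ≤ b₁ + b₂ + s → 2 ≤ b₂ ⊎ 4 ≤ a₁ + b₂ + s ⊎ 4 ≤ b₁ + b₂ + s → ⊥
  cases (inj₂ (inj₂ h)) _ = b₁+b₂+s≱4 h
  cases _ (inj₂ (inj₂ h)) = b₁+b₂+s≱4 h
  cases (inj₁ h₁) (inj₁ h₂) = both-big h₁ h₂
  cases (inj₂ (inj₁ h₁)) (inj₂ (inj₁ h₂)) = mixed h₁ h₂
  cases (inj₁ h₁) (inj₂ (inj₁ h₂)) = lopsided a₁ b₁ b₂ sep₁ h₁ h₂ b₁+b₂+s≤3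
  cases (inj₂ (inj₁ h₁)) (inj₁ h₂) =
    lopsided a₂ b₂ b₁ sep₂ h₂ (≤-trans h₁ (≤-reflexive (swap-ends b₁ a₂)))
      (≤-trans (≤-reflexive (swap-ends b₂ b₁)) b₁+b₂+s≤3)

module Crossing {n : ℕ} {G : Graph n} (simple : Simple G) (c4 : Connectedₖ 4 G) {x y z : Fin n}
  (xy : E G x y ≡ true) (xz : E G x z ≡ true) (deg-x : 5 ≤ deg G x)
  (first : NearSeparation G x y z) (second : NearSeparation G x z y) where

  open SimpleGraph simple
  module P = Sides simple first
  module Q = Sides simple second

  corner : Side → Side → Fin n → Bool
  corner σ τ = P.side σ ∩ Q.side τ

  border : Side → Side → Fin n → Bool
  border σ τ u = (P.side σ ∩ Q.sep) u ∨ ((P.sep ∩ Q.side τ) u ∨ (P.sep ∩ Q.sep) u)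

  inQsep : Side → ℕ
  inQsep σ = count (P.side σ ∩ Q.sep)

  inPsep : Side → ℕ
  inPsep τ = count (P.sep ∩ Q.side τ)

  inBoth : ℕ
  inBoth = count (P.sep ∩ Q.sep)

  border-count : ∀ σ τ → count (border σ τ) ≤ inQsep σ + inPsep τ + inBoth
  border-count σ τ = ≤-trans (count-∨ (P.side σ ∩ Q.sep) _)
    (≤-trans (+-monoʳ-≤ (inQsep σ) (count-∨ (P.sep ∩ Q.side τ) (P.sep ∩ Q.sep)))
      (≤-reflexive (sym (+-assoc (inQsep σ) (inPsep τ) inBoth))))

  beyond : Side → Fin n
  beyond near = y
  beyond far = x

  beyond-V : ∀ σ → V G (beyond σ) ≡ true
  beyond-V near = E-Vʳ xy
  beyond-V far = E-Vˡ xy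

  beyond-sep : ∀ σ → P.sep (beyond σ) ≡ false
  beyond-sep near = cong (_∧ V G y) P.y∉S
  beyond-sep far = P.side-sep near P.x∈near

  beyond-side : ∀ σ → P.side σ (beyond σ) ≡ false
  beyond-side near = P.y∉A
  beyond-side far = P.x∉far

  fence : Side → Side → Fin n → Bool
  fence σ τ u = border σ τ u ∨ (corner σ τ ∩ (_=ᵛ x)) u

  interior : Side → Side → Fin n → Bool
  interior σ τ u = corner σ τ u ∧ not (u =ᵛ x)

  fence-false : ∀ σ τ {u} → P.side σ u ≡ false → P.sep u ≡ false → fence σ τ u ≡ false
  fence-false σ τ f s =
    ∨-false (∨-false (∩-falseˡ (P.side σ) Q.sep f) (∨-false (∩-falseˡ P.sep (Q.side τ) s) (∩-falseˡ P.sep Q.sep s)))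
      (∩-falseˡ (corner σ τ) (_=ᵛ x) (∩-falseˡ (P.side σ) (Q.side τ) f))

  -- An edge leaving a corner crosses one of the two separations, so it is xy or xz and starts at x.
  interior-closed : ∀ σ τ → ClosedOutside G (fence σ τ) (interior σ τ)
  interior-closed σ τ {p} {q} ip vq fq e = settle (P.locate σ vq) (Q.locate τ vq)
    where
    cp = ∧⁻ˡ ip
    pσ = ∧⁻ˡ cp
    pτ = ∧⁻ʳ {P.side σ p} cp
    p≢x = =ᵛ-false (not-true (∧⁻ʳ {corner σ τ p} ip))
    fenced : fence σ τ q ≡ true → ⊥
    fenced t = true≢false t fq
    not-across-P : P.side (opposite σ) q ≡ true → ⊥
    not-across-P q′ = [ (λ (p≡x , _) → p≢x p≡x)
                      , (λ (p≡y , _) → true≢false (subst (λ t → Q.S t ≡ true) (sym p≡y) Q.z∈S) (Q.side-S τ pτ)) ]′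
                      (P.crossing σ pσ q′ e)
    not-across-Q : Q.side (opposite τ) q ≡ true → ⊥
    not-across-Q q′ = [ (λ (p≡x , _) → p≢x p≡x)
                      , (λ (p≡z , _) → true≢false (subst (λ t → P.S t ≡ true) (sym p≡z) P.z∈S) (P.side-S σ pσ)) ]′
                      (Q.crossing τ pτ q′ e)
    settle : P.sep q ≡ true ⊎ P.side σ q ≡ true ⊎ P.side (opposite σ) q ≡ true →
             Q.sep q ≡ true ⊎ Q.side τ q ≡ true ⊎ Q.side (opposite τ) q ≡ true → interior σ τ q ≡ true
    settle (inj₂ (inj₂ q′)) _ = ⊥-elim (not-across-P q′)
    settle _ (inj₂ (inj₂ q′)) = ⊥-elim (not-across-Q q′)
    settle (inj₁ s) (inj₁ s′) =
      ⊥-elim (fenced (∨⁺ˡ (∨⁺ʳ {(P.side σ ∩ Q.sep) q} (∨⁺ʳ {(P.sep ∩ Q.side τ) q} (∧⁺ s s′)))))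
    settle (inj₁ s) (inj₂ (inj₁ qτ)) = ⊥-elim (fenced (∨⁺ˡ (∨⁺ʳ {(P.side σ ∩ Q.sep) q} (∨⁺ˡ (∧⁺ s qτ)))))
    settle (inj₂ (inj₁ qσ)) (inj₁ s′) = ⊥-elim (fenced (∨⁺ˡ (∨⁺ˡ (∧⁺ qσ s′))))
    settle (inj₂ (inj₁ qσ)) (inj₂ (inj₁ qτ)) = ∧⁺ (∧⁺ qσ qτ) (not-false q≢x)
      where
      q≢x : q =ᵛ x ≡ false
      q≢x with true-or-false (q =ᵛ x)
      ... | inj₂ f = f
      ... | inj₁ t = ⊥-elim (fenced (∨⁺ʳ {border σ τ q} (∧⁺ (∧⁺ qσ qτ) t)))

  cut-off : ∀ σ τ {v} → corner σ τ v ≡ true → v ≢ x → 4 ≤ count (border σ τ) + count (corner σ τ ∩ (_=ᵛ x))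
  cut-off σ τ {v} cv v≢x =
    ≤-trans separated (≤-trans (count-mono {p = λ u → fence σ τ u ∧ V G u} {q = fence σ τ} (λ _ → ∧⁻ˡ))
      (count-∨ (border σ τ) (corner σ τ ∩ (_=ᵛ x))))
    where
    vσ = ∧⁻ˡ cv
    vτ = ∧⁻ʳ {P.side σ v} cv
    v∉fence : fence σ τ v ≡ false
    v∉fence = ∨-false (∨-false (∩-falseʳ (P.side σ) Q.sep (Q.side-sep τ vτ))
                (∨-false (∩-falseˡ P.sep (Q.side τ) (P.side-sep σ vσ)) (∩-falseˡ P.sep Q.sep (P.side-sep σ vσ))))
                (∩-falseʳ (corner σ τ) (_=ᵛ x) (=ᵛ-≢ v≢x))
    separated = separator≥4 c4 (fence σ τ) (interior σ τ) (interior-closed σ τ) {v} {beyond σ}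
      (∧⁺ cv (not-false (=ᵛ-≢ v≢x))) (P.side-V σ vσ) v∉fence
      (beyond-V σ) (fence-false σ τ (beyond-side σ) (beyond-sep σ))
      (∩-falseˡ (corner σ τ) (λ u → not (u =ᵛ x)) (∩-falseˡ (P.side σ) (Q.side τ) (beyond-side σ)))

  corner-bound : ∀ σ τ {v} → corner σ τ v ≡ true → v ≢ x → corner σ τ x ≡ false → 4 ≤ inQsep σ + inPsep τ + inBoth
  corner-bound σ τ cv v≢x x∉corner = ≤-trans (cut-off σ τ cv v≢x) (≤-trans (≤-reflexive only-border) (border-count σ τ))
    where
    only-border : count (border σ τ) + count (corner σ τ ∩ (_=ᵛ x)) ≡ count (border σ τ)
    only-border = trans (cong (count (border σ τ) +_) (count-none (corner σ τ ∩ (_=ᵛ x)) no-x)) (+-identityʳ _)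
      where
      no-x : ∀ u → (corner σ τ ∩ (_=ᵛ x)) u ≡ false
      no-x u with true-or-false (u =ᵛ x)
      ... | inj₂ f = ∩-falseʳ (corner σ τ) (_=ᵛ x) f
      ... | inj₁ t = ∩-falseˡ (corner σ τ) (_=ᵛ x) (subst (λ w → corner σ τ w ≡ false) (sym (=ᵛ-sound t)) x∉corner)

  Q-sep-split : inQsep near + inQsep far + inBoth ≤ 3
  Q-sep-split = ≤-trans (count-disjoint₃ (P.side near ∩ Q.sep) (P.side far ∩ Q.sep) (P.sep ∩ Q.sep) Q.sep
    (λ u e → ∩-falseˡ (P.side far) Q.sep (P.near-far (∧⁻ˡ e)))
    (λ u e → ∩-falseˡ P.sep Q.sep (P.side-sep near (∧⁻ˡ e)))
    (λ u e → ∩-falseˡ P.sep Q.sep (P.side-sep far (∧⁻ˡ e)))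
    (λ u → ∧⁻ʳ {P.side near u}) (λ u → ∧⁻ʳ {P.side far u}) (λ u → ∧⁻ʳ {P.sep u})) Q.|S|≤3

  P-sep-split : inPsep near + inPsep far + inBoth ≤ 3
  P-sep-split = ≤-trans (count-disjoint₃ (P.sep ∩ Q.side near) (P.sep ∩ Q.side far) (P.sep ∩ Q.sep) P.sep
    (λ u e → ∩-falseʳ P.sep (Q.side far) (Q.near-far (∧⁻ʳ {P.sep u} e)))
    (λ u e → ∩-falseʳ P.sep Q.sep (Q.side-sep near (∧⁻ʳ {P.sep u} e)))
    (λ u e → ∩-falseʳ P.sep Q.sep (Q.side-sep far (∧⁻ʳ {P.sep u} e)))
    (λ _ → ∧⁻ˡ) (λ _ → ∧⁻ˡ) (λ _ → ∧⁻ˡ)) P.|S|≤3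

  -- x has at least three neighbours besides y and z, all in A ∩ A′ or on the border of that corner.
  near-degree : 3 ≤ inQsep near + inPsep near + inBoth
  near-degree = ≤-trans border≥3 (border-count near near)
    where
    Inner : Fin n → Bool
    Inner u = corner near near u ∧ not (u =ᵛ x)
    neighbour : ∀ u → Adj G x u ≡ true → (u =ᵛ y) ∨ ((u =ᵛ z) ∨ (Inner u ∨ border near near u)) ≡ true
    neighbour u a with true-or-false (u =ᵛ y) | true-or-false (u =ᵛ z)
    ... | inj₁ u≡y | _ = ∨⁺ˡ u≡y
    ... | inj₂ _ | inj₁ u≡z = ∨⁺ʳ {u =ᵛ y} (∨⁺ˡ u≡z)
    ... | inj₂ u≢y | inj₂ u≢z = ∨⁺ʳ {u =ᵛ y} (∨⁺ʳ {u =ᵛ z} (place (P.locate near vu) (Q.locate near vu)))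
      where
      vu = Adj-Vʳ G a
      e = Adj-E G a
      place : P.sep u ≡ true ⊎ P.side near u ≡ true ⊎ P.side far u ≡ true →
              Q.sep u ≡ true ⊎ Q.side near u ≡ true ⊎ Q.side far u ≡ true → Inner u ∨ border near near u ≡ true
      place (inj₂ (inj₂ u-far)) _ = ⊥-elim ([ (λ (_ , u≡y) → =ᵛ-false u≢y u≡y) , (λ (x≡y , _) → E-≢ xy x≡y) ]′
                                               (P.crossing near P.x∈near u-far e))
      place _ (inj₂ (inj₂ u-far)) = ⊥-elim ([ (λ (_ , u≡z) → =ᵛ-false u≢z u≡z) , (λ (x≡z , _) → E-≢ xz x≡z) ]′
                                               (Q.crossing near Q.x∈near u-far e))
      place (inj₁ s) (inj₁ s′) =
        ∨⁺ʳ {Inner u} (∨⁺ʳ {(P.side near ∩ Q.sep) u} (∨⁺ʳ {(P.sep ∩ Q.side near) u} (∧⁺ s s′)))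
      place (inj₁ s) (inj₂ (inj₁ a′)) = ∨⁺ʳ {Inner u} (∨⁺ʳ {(P.side near ∩ Q.sep) u} (∨⁺ˡ (∧⁺ s a′)))
      place (inj₂ (inj₁ a)) (inj₁ s′) = ∨⁺ʳ {Inner u} (∨⁺ˡ (∧⁺ a s′))
      place (inj₂ (inj₁ a)) (inj₂ (inj₁ a′)) = ∨⁺ˡ (∧⁺ (∧⁺ a a′) (not-false (=ᵛ-≢ (λ u≡x → E-≢ e (sym u≡x)))))
    degree : 5 ≤ 1 + (1 + (count Inner + count (border near near)))
    degree = ≤-trans (subst (5 ≤_) (#≡count (Adj G x)) deg-x) (≤-trans (count-mono neighbour)
      (≤-trans (count-∨ (_=ᵛ y) _) (+-mono-≤ (count-=ᵛ y)
      (≤-trans (count-∨ (_=ᵛ z) _) (+-mono-≤ (count-=ᵛ z) (count-∨ Inner (border near near)))))))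
    border≥3 : 3 ≤ count (border near near)
    border≥3 with 1 ≤? count Inner
    ... | no empty =
      +-cancelˡ-≤ 2 3 _ (subst (λ k → 5 ≤ 1 + (1 + (k + count (border near near)))) (n<1⇒n≡0 (≰⇒> empty)) degree)
    ... | yes nonempty = +-cancelʳ-≤ 1 3 _ (≤-trans (cut-off near near (∧⁻ˡ inner) v≢x)
                           (+-monoʳ-≤ (count (border near near)) x-at-most-once))
      where
      x-at-most-once : count (corner near near ∩ (_=ᵛ x)) ≤ 1
      x-at-most-once = ≤-trans (count-mono {p = corner near near ∩ (_=ᵛ x)} {q = _=ᵛ x} (λ u → ∧⁻ʳ {corner near near u}))
                         (count-=ᵛ x)
      v = proj₁ (1≤count⇒∃ Inner nonempty)
      inner = proj₂ (1≤count⇒∃ Inner nonempty)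
      v≢x = =ᵛ-false (not-true (∧⁻ʳ {corner near near v} inner))

  first-witness : 2 ≤ inQsep far ⊎ 4 ≤ inQsep far + inPsep near + inBoth ⊎ 4 ≤ inQsep far + inPsep far + inBoth
  first-witness with Q.locate near P.b∈V
  ... | inj₁ s′ = inj₁ (2≤count (P.side far ∩ Q.sep) (∧⁺ P.b∈far s′) (∧⁺ (P.y∈far y∈V) (Q.sep⁺ Q.z∈S y∈V)) P.b≢y)
    where y∈V = E-Vʳ xy
  ... | inj₂ (inj₁ a′) =
    inj₂ (inj₁ (corner-bound far near (∧⁺ P.b∈far a′) b≢x (∩-falseˡ (P.side far) (Q.side near) P.x∉far)))
    where b≢x = member-≢ (P.side far) P.b∈far P.x∉far
  ... | inj₂ (inj₂ f′) = inj₂ (inj₂ (corner-bound far far (∧⁺ P.b∈far f′) b≢x (∩-falseˡ (P.side far) (Q.side far) P.x∉far)))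
    where b≢x = member-≢ (P.side far) P.b∈far P.x∉far

  second-witness : 2 ≤ inPsep far ⊎ 4 ≤ inQsep near + inPsep far + inBoth ⊎ 4 ≤ inQsep far + inPsep far + inBoth
  second-witness with P.locate near Q.b∈V
  ... | inj₁ s = inj₁ (2≤count (P.sep ∩ Q.side far) (∧⁺ s Q.b∈far) (∧⁺ (P.sep⁺ P.z∈S z∈V) (Q.y∈far z∈V)) Q.b≢y)
    where z∈V = E-Vʳ xz
  ... | inj₂ (inj₁ a) = inj₂ (inj₁ (corner-bound near far (∧⁺ a Q.b∈far) c≢x (∩-falseʳ (P.side near) (Q.side far) Q.x∉far)))
    where c≢x = member-≢ (Q.side far) Q.b∈far Q.x∉far
  ... | inj₂ (inj₂ f) = inj₂ (inj₂ (corner-bound far far (∧⁺ f Q.b∈far) c≢x (∩-falseˡ (P.side far) (Q.side far) P.x∉far)))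
    where c≢x = member-≢ (Q.side far) Q.b∈far Q.x∉far

  contradiction : ⊥
  contradiction = crossing-arithmetic (inQsep near) (inQsep far) (inPsep near) (inPsep far) inBoth
    Q-sep-split P-sep-split near-degree first-witness second-witness

lemma4 : {n : ℕ} (G : Graph n) → Simple G → Connectedₖ 4 G → 7 ≤ order G →
    (x y z : Fin n) → E G x y ≡ true → E G y z ≡ true → E G x z ≡ true →
    5 ≤ deg G x →
    ∃ λ w → (w ≡ y ⊎ w ≡ z) × E G x w ≡ true × Removable G x w
lemma4 G simple c4 order≥7 x y z xy yz xz deg-x
  with connected₄-or-obstruction (G ⊖ (x , y)) | connected₄-or-obstruction (G ⊖ (x , z))
... | inj₁ removable | _ = y , inj₁ refl , xy , removable
... | inj₂ _ | inj₁ removable = z , inj₂ refl , xz , removable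
... | inj₂ obstruction-xy | inj₂ obstruction-xz = ⊥-elim (Crossing.contradiction simple c4 xy xz deg-x
        (NonRemovable.nearSeparation simple c4 order≥7 xy yz xz deg-x obstruction-xy)
        (NonRemovable.nearSeparation simple c4 order≥7 xz (SimpleGraph.E-sym simple yz) xy deg-x obstruction-xz))
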